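{- Let $S$ be a closed context-free semi-Thue system over $\Sigma$. For every rule $u\to v\in S$, the structural rule deriving $v\{\Delta\},\Gamma$ from $u\{\Delta\},\Gamma$ is height-preserving admissible in $\mathrm{DKm}(S)$.
   Context: $\Sigma$: alphabet with involution $a\mapsto\bar a$; $\overline{a_1\cdots a_n}=\bar a_n\cdots\bar a_1$. A semi-Thue system $S$ is a set of rules $u\to v$ ($u,v\in\Sigma^*$); closed if $u\to v\in S\Rightarrow\bar u\to\bar v\in S$; context-free if all rules have form $a\to u$, $a\in\Sigma$. $L_a(S)=\{u\mid a\Rightarrow_S u\}$. Formulae are in negation normal form. A nested sequent is a finite multiset of formulae and structures $a\{\Delta\}$ (comma = multiset union); $u\{\Delta\}=a_1\{\cdots a_n\{\Delta\}\cdots\}$ for $u=a_1\cdots a_n$, $\epsilon\{\Delta\}=\Delta$. It is viewed as a tree with nodes carrying multisets of formulae and $\Sigma$-labelled edges. Contexts $\Gamma[\ ]$, $\Gamma[\ ]_i[\ ]_j$ have holes at nodes. $\mathcal R(\Gamma,i,j)$: automaton with the nodes as states, initial $i$, final $j$, transitions $x\xrightarrow{a}y$, $y\xrightarrow{\bar a}x$ for each edge $x\xrightarrow{a}y$. $\mathrm{DKm}(S)$ rules (conclusion from premises): $\mathit{id}_d$: $\Gamma[p,\neg p]$; $\land_d$: $\Gamma[A\land B]$ from $\Gamma[A\land B,A]$, $\Gamma[A\land B,B]$; $\lor_d$: $\Gamma[A\lor B]$ from $\Gamma[A\lor B,A,B]$; $[a]_d$: $\Gamma[[a]A]$ from $\Gamma[[a]A,a\{A\}]$;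 $\langle a\rangle\!\uparrow$: $\Gamma[a\{\Delta\},\langle a\rangle A]$ from $\Gamma[a\{\Delta,A\},\langle a\rangle A]$; $\langle a\rangle\!\downarrow$: $\Gamma[a\{\Delta,\langle\bar a\rangle A\}]$ from $\Gamma[a\{\Delta,\langle\bar a\rangle A\},A]$; $p_S$: $\Gamma[\langle a\rangle A]_i[\emptyset]_j$ from $\Gamma[\langle a\rangle A]_i[A]_j$ provided $\mathcal R(\Gamma[\ ]_i[\ ]_j,i,j)\cap L_a(S)\neq\emptyset$. Height-preserving admissible: whenever the premise has a derivation of height $h$, so does the conclusion. -}

module Defs where

open import Data.Nat using (ℕ; zero; suc)
open import Data.List using (List; []; _∷_; _++_; [_]; map; reverse)
open import Data.List.Membership.Propositional using (_∈_)
open import Data.Product using (Σ; _×_; _,_; ∃; ∃-syntax)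
open import Relation.Binary.PropositionalEquality using (_≡_)
open import Relation.Binary.Construct.Closure.ReflexiveTransitive using (Star)

module _ {Sig : Set} where

  STS : Set₁
  STS = List Sig → List Sig → Set

  ContextFree : STS → Set
  ContextFree S = ∀ u v → S u v → ∃[ a ] (u ≡ [ a ])

  data Step (S : STS) : List Sig → List Sig → Set where
    step : ∀ {u v} x y → S u v → Step S (x ++ u ++ y) (x ++ v ++ y)

  _⇒[_]_ : List Sig → STS → List Sig → Set
  w ⇒[ S ] w' = Star (Step S) w w'

  L : STS → Sig → List Sig → Set
  L S a u = [ a ] ⇒[ S ] u

  data Fml : Set where
    pos  : ℕ → Fml
    neg  : ℕ → Fml
    _∧_  : Fml → Fml → Fml
    _∨_  : Fml → Fml → Fml
    box  : Sig → Fml → Fml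
    dia  : Sig → Fml → Fml

  -- Nested sequents: a node carries its formulae and its a-labelled
  -- children (a{Δ}).  Lists represent multisets; all rules below are
  -- insensitive to the order of the lists.

  data Seq : Set where
    node : List Fml → List (Sig × Seq) → Seq

  _,,_ : Seq → Seq → Seq
  node fs cs ,, node gs ds = node (fs ++ gs) (cs ++ ds)

  wrap : List Sig → Seq → Seq
  wrap []      Δ = Δ
  wrap (a ∷ u) Δ = node [] ((a , wrap u Δ) ∷ [])

  -- Node addresses: list of child indices from the root.
  Addr : Set
  Addr = List ℕ

  data Child : List (Sig × Seq) → ℕ → Sig → Seq → Set where
    cz : ∀ {a Δ cs} → Child ((a , Δ) ∷ cs) zero a Δ
    cs : ∀ {c cs k a Δ} → Child cs k a Δ → Child (c ∷ cs) (suc k) a Δ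

  data RepL : List (Sig × Seq) → ℕ → Sig → Seq → Seq → List (Sig × Seq) → Set where
    rz : ∀ {a Δ Δ' cs} → RepL ((a , Δ) ∷ cs) zero a Δ Δ' ((a , Δ') ∷ cs)
    rs : ∀ {c cs k a Δ Δ' cs'} → RepL cs k a Δ Δ' cs' → RepL (c ∷ cs) (suc k) a Δ Δ' (c ∷ cs')

  data At : Seq → Addr → Seq → Set where
    here  : ∀ {n} → At n [] n
    there : ∀ {fs cs k a Δ x n} → Child cs k a Δ → At Δ x n → At (node fs cs) (k ∷ x) n

  data Rep : Seq → Addr → Seq → Seq → Seq → Set where
    here  : ∀ {n n'} → Rep n [] n n' n'
    there : ∀ {fs cs k a Δ Δ' cs' x n n'} →
            RepL cs k a Δ Δ' cs' → Rep Δ x n n' Δ' →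
            Rep (node fs cs) (k ∷ x) n n' (node fs cs')

module _ {Sig : Set} (bar : Sig → Sig) where

  barW : List Sig → List Sig
  barW w = reverse (map bar w)

  Closed : STS {Sig} → Set
  Closed S = ∀ u v → S u v → S (barW u) (barW v)

  -- Runs of the automaton R(Γ, i, j): states are nodes (addresses);
  -- an edge x -a-> y gives transitions x -a-> y and y -bar a-> x.
  data Walk (Γ : Seq {Sig}) : List ℕ → List Sig → List ℕ → Set where
    nil  : ∀ {x n} → At Γ x n → Walk Γ x [] x
    down : ∀ {x fs cs k a Δ w y} → At Γ x (node fs cs) → Child cs k a Δ →
           Walk Γ (x ++ [ k ]) w y → Walk Γ x (a ∷ w) y
    up   : ∀ {x fs cs k a Δ w y} → At Γ x (node fs cs) → Child cs k a Δ →
           Walk Γ x w y → Walk Γ (x ++ [ k ]) (bar a ∷ w) y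

  -- DKm(S).  Der S h Γ : Γ has a DKm(S)-derivation of height ≤ h
  -- (axioms have height 0; each other rule adds 1).

  data Der (S : STS {Sig}) : ℕ → Seq {Sig} → Set where
    id-d   : ∀ {h Γ x fs cs p} → At Γ x (node fs cs) →
             pos p ∈ fs → neg p ∈ fs → Der S h Γ
    and-d  : ∀ {h Γ Γ₁ Γ₂ x fs cs A B} →
             A ∧ B ∈ fs →
             Rep Γ x (node fs cs) (node (A ∷ fs) cs) Γ₁ →
             Rep Γ x (node fs cs) (node (B ∷ fs) cs) Γ₂ →
             Der S h Γ₁ → Der S h Γ₂ → Der S (suc h) Γ
    or-d   : ∀ {h Γ Γ₁ x fs cs A B} →
             A ∨ B ∈ fs →
             Rep Γ x (node fs cs) (node (A ∷ B ∷ fs) cs) Γ₁ →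
             Der S h Γ₁ → Der S (suc h) Γ
    box-d  : ∀ {h Γ Γ₁ x fs cs a A} →
             box a A ∈ fs →
             Rep Γ x (node fs cs) (node fs ((a , node (A ∷ []) []) ∷ cs)) Γ₁ →
             Der S h Γ₁ → Der S (suc h) Γ
    dia-up : ∀ {h Γ Γ₁ x fs cs cs' k a gs ds A} →
             dia a A ∈ fs → Child cs k a (node gs ds) →
             RepL cs k a (node gs ds) (node (A ∷ gs) ds) cs' →
             Rep Γ x (node fs cs) (node fs cs') Γ₁ →
             Der S h Γ₁ → Der S (suc h) Γ
    dia-dn : ∀ {h Γ Γ₁ x fs cs k a gs ds A} →
             Child cs k a (node gs ds) → dia (bar a) A ∈ gs →
             Rep Γ x (node fs cs) (node (A ∷ fs) cs) Γ₁ →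
             Der S h Γ₁ → Der S (suc h) Γ
    p-S    : ∀ {h Γ Γ₁ i j fs cs gs ds a A} →
             At Γ i (node fs cs) → dia a A ∈ fs →
             Rep Γ j (node gs ds) (node (A ∷ gs) ds) Γ₁ →
             (∃[ w ] (L S a w × Walk Γ i w j)) →
             Der S h Γ₁ → Der S (suc h) Γ

-- A simulation of a sequent Γ in a sequent Γ′ maps the nodes of Γ to nodes of Γ′, keeping
-- their formulae, and every a-edge (read downwards, resp. upwards) to a path of Γ′ whose label
-- lies in L_a(S) (resp. L_ā(S)).  Derivations transfer along simulations without increasing
-- the height: each rule instance is replayed at the image of its principal node, the premises
-- are again related by a simulation, and ⟨a⟩↑, ⟨a⟩↓ and p_S all become instances of p_S,
-- because the image of a path labelled w is a path labelled w′ with w ⇒_S w′.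
-- For a rule a → v of a context-free system, v{Δ},Γ simulates a{Δ},Γ: the a-edge goes to the
-- chain v, or is collapsed when v is empty; its label v lies in L_a(S) by the rule itself and
-- the reversed label in L_ā(S) by closedness.
module Submission where

open import Defs
open import Data.Nat using (ℕ; zero; suc; _+_; _≟_)
open import Data.Fin using (Fin)
open import Data.List using (List; []; _∷_; _++_; [_]; map; length)
open import Data.List.Properties using (++-assoc; ++-identityʳ; unfold-reverse; ∷-injective)
open import Data.List.Membership.Propositional using (_∈_)
open import Data.List.Membership.Propositional.Properties using (∈-++⁺ˡ; ∈-++⁺ʳ; ∈-++⁻)
open import Data.List.Relation.Binary.Subset.Propositional using (_⊆_)
open import Data.Maybe as Maybe using (Maybe; just; nothing; maybe′)
open import Data.Product using (Σ; _×_; _,_; proj₁; proj₂; ∃-syntax)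
open import Data.Sum using (_⊎_; inj₁; inj₂)
open import Function using (id; _∘_; case_of_)
open import Relation.Nullary using (yes; no; contradiction)
open import Relation.Binary.PropositionalEquality using (_≡_; refl; sym; trans; cong; subst; subst₂)
open import Relation.Binary.Construct.Closure.ReflexiveTransitive using (ε; _◅_; _◅◅_; gmap)

module _ {Sig : Set} where

  Sequent : Set
  Sequent = Seq {Sig}

  Formulae : Set
  Formulae = List (Fml {Sig})

  Children : Set
  Children = List (Sig × Sequent)

  labels : Children → List Sig
  labels = map proj₁

  NodeAt : Sequent → List ℕ → Set
  NodeAt Γ x = Σ Formulae λ fs → Σ Children λ ds → At Γ x (node fs ds)

  FormulaAt : Sequent → List ℕ → Fml {Sig} → Set
  FormulaAt Γ x A = Σ Formulae λ fs → Σ Children λ ds → At Γ x (node fs ds) × A ∈ fs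

  Child-functional : ∀ {ds : Children} {k a b E E′} → Child ds k a E → Child ds k b E′ → a ≡ b × E ≡ E′
  Child-functional cz     cz      = refl , refl
  Child-functional (cs c) (cs c′) = Child-functional c c′

  Child-sameLabels : ∀ {ds es : Children} {k a E} → labels ds ≡ labels es → Child ds k a E → ∃[ E′ ] Child es k a E′
  Child-sameLabels {es = []}    ()  cz
  Child-sameLabels {es = []}    ()  (cs c)
  Child-sameLabels {es = _ ∷ _} eq  cz with refl , _ ← ∷-injective eq = _ , cz
  Child-sameLabels {es = _ ∷ _} eq  (cs c) =
    let (E′ , c′) = Child-sameLabels (proj₂ (∷-injective eq)) c in E′ , cs c′

  Child-++⁺ˡ : ∀ {ds es : Children} {k a E} → Child ds k a E → Child (ds ++ es) k a E
  Child-++⁺ˡ cz     = cz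
  Child-++⁺ˡ (cs c) = cs (Child-++⁺ˡ c)

  Child-++⁺ʳ : ∀ (ds : Children) {es k a E} → Child es k a E → Child (ds ++ es) (length ds + k) a E
  Child-++⁺ʳ []       c = c
  Child-++⁺ʳ (_ ∷ ds) c = cs (Child-++⁺ʳ ds c)

  RepL-labels : ∀ {ds es : Children} {k a E E′} → RepL ds k a E E′ es → labels ds ≡ labels es
  RepL-labels rz     = refl
  RepL-labels (rs r) = cong (_ ∷_) (RepL-labels r)

  RepL-old : ∀ {ds es : Children} {k a E E′} → RepL ds k a E E′ es → Child ds k a E
  RepL-old rz     = cz
  RepL-old (rs r) = cs (RepL-old r)

  RepL-new : ∀ {ds es : Children} {k a E E′} → RepL ds k a E E′ es → Child es k a E′
  RepL-new rz     = cz
  RepL-new (rs r) = cs (RepL-new r)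

  RepL-sym : ∀ {ds es : Children} {k a E E′} → RepL ds k a E E′ es → RepL es k a E′ E ds
  RepL-sym rz     = rz
  RepL-sym (rs r) = rs (RepL-sym r)

  RepL-child : ∀ {ds es : Children} {k a E E′ j b G} → RepL ds k a E E′ es → Child ds j b G →
               (j ≡ k × b ≡ a × G ≡ E) ⊎ Child es j b G
  RepL-child rz     cz     = inj₁ (refl , refl , refl)
  RepL-child rz     (cs c) = inj₂ (cs c)
  RepL-child (rs r) cz     = inj₂ cz
  RepL-child (rs r) (cs c) with RepL-child r c
  ... | inj₁ (refl , b≡a , G≡E) = inj₁ (refl , b≡a , G≡E)
  ... | inj₂ c′                 = inj₂ (cs c′)

  Child⇒RepL : ∀ {ds : Children} {k a E} → Child ds k a E → (E′ : Sequent) → ∃[ es ] RepL ds k a E E′ es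
  Child⇒RepL cz     E′ = _ , rz
  Child⇒RepL (cs c) E′ = let (_ , r) = Child⇒RepL c E′ in _ , rs r

  At-functional : ∀ {Γ : Sequent} {x E E′} → At Γ x E → At Γ x E′ → E ≡ E′
  At-functional here        here          = refl
  At-functional (there c p) (there c′ p′) with refl , refl ← Child-functional c c′ = At-functional p p′

  At-child : ∀ {Γ : Sequent} {x fs ds k a E} → At Γ x (node fs ds) → Child ds k a E → At Γ (x ++ [ k ]) E
  At-child here        c′ = there c′ here
  At-child (there c p) c′ = there c (At-child p c′)

  Rep-sym : ∀ {Γ Γ₁ : Sequent} {x E E′} → Rep Γ x E E′ Γ₁ → Rep Γ₁ x E′ E Γ
  Rep-sym here         = here
  Rep-sym (there rl r) = there (RepL-sym rl) (Rep-sym r)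

  Rep-old : ∀ {Γ Γ₁ : Sequent} {x E E′} → Rep Γ x E E′ Γ₁ → At Γ x E
  Rep-old here         = here
  Rep-old (there rl r) = there (RepL-old rl) (Rep-old r)

  Rep-new : ∀ {Γ Γ₁ : Sequent} {x E E′} → Rep Γ x E E′ Γ₁ → At Γ₁ x E′
  Rep-new = Rep-old ∘ Rep-sym

  At⇒Rep : ∀ {Γ : Sequent} {x E} → At Γ x E → (E′ : Sequent) → ∃[ Γ₁ ] Rep Γ x E E′ Γ₁
  At⇒Rep here        E′ = E′ , here
  At⇒Rep (there c p) E′ =
    let (_ , r)  = At⇒Rep p E′
        (_ , rl) = Child⇒RepL c _
    in _ , there rl r

  Rep-child : ∀ {Γ Γ₁ : Sequent} {x fs ds es k a E E′} →
              Rep Γ x (node fs ds) (node fs es) Γ₁ → RepL ds k a E E′ es → Rep Γ (x ++ [ k ]) E E′ Γ₁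
  Rep-child here         rl = there rl here
  Rep-child (there rl r) rl′ = there rl (Rep-child r rl′)

  update-At : ∀ {Γ Γ₁ : Sequent} {x fs gs ds y hs es} →
              Rep Γ x (node fs ds) (node gs ds) Γ₁ → At Γ y (node hs es) →
              Σ Formulae λ hs′ → Σ Children λ es′ → At Γ₁ y (node hs′ es′) ×
                labels es ≡ labels es′ × (hs′ ≡ hs ⊎ (y ≡ x × hs ≡ fs × hs′ ≡ gs))
  update-At here         here        = _ , _ , here , refl , inj₂ (refl , refl , refl)
  update-At here         (there c p) = _ , _ , there c p , refl , inj₁ refl
  update-At (there rl r) here        = _ , _ , here , RepL-labels rl , inj₁ refl
  update-At (there rl r) (there c p) with RepL-child rl c
  ... | inj₂ c′ = _ , _ , there c′ p , refl , inj₁ refl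
  ... | inj₁ (refl , refl , refl) with update-At r p
  ...   | hs′ , es′ , p′ , l , inj₁ e =
    hs′ , es′ , there (RepL-new rl) p′ , l , inj₁ e
  ...   | hs′ , es′ , p′ , l , inj₂ (y≡x , e₁ , e₂) =
    hs′ , es′ , there (RepL-new rl) p′ , l , inj₂ (cong (_ ∷_) y≡x , e₁ , e₂)

  -- box_d inserts a new first child at x: shift x sends each old address to its new one, and
  -- unshift x inverts it, with nothing on the new child x ++ [ 0 ].  insertMap φ x is then the
  -- address map induced on the premises of box_d from the map φ on the conclusions.
  shift : List ℕ → List ℕ → List ℕ
  shift _       []      = []
  shift []      (k ∷ y) = suc k ∷ y
  shift (i ∷ x) (k ∷ y) with i ≟ k
  ... | yes _ = k ∷ shift x y
  ... | no  _ = k ∷ y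

  unshift : List ℕ → List ℕ → Maybe (List ℕ)
  unshift _       []          = just []
  unshift []      (zero ∷ y)  = nothing
  unshift []      (suc k ∷ y) = just (k ∷ y)
  unshift (i ∷ x) (k ∷ y) with i ≟ k
  ... | yes _ = Maybe.map (k ∷_) (unshift x y)
  ... | no  _ = just (k ∷ y)

  shift-self : ∀ x → shift x x ≡ x
  shift-self []      = refl
  shift-self (i ∷ x) with i ≟ i
  ... | yes _   = cong (i ∷_) (shift-self x)
  ... | no  i≢i = contradiction refl i≢i

  unshift-self : ∀ x → unshift x x ≡ just x
  unshift-self []      = refl
  unshift-self (i ∷ x) with i ≟ i
  ... | yes _   = cong (Maybe.map (i ∷_)) (unshift-self x)
  ... | no  i≢i = contradiction refl i≢i

  unshift-new : ∀ x → unshift x (x ++ [ 0 ]) ≡ nothing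
  unshift-new []      = refl
  unshift-new (i ∷ x) with i ≟ i
  ... | yes _   = cong (Maybe.map (i ∷_)) (unshift-new x)
  ... | no  i≢i = contradiction refl i≢i

  shift-root-child : ∀ i x k → shift (i ∷ x) [ k ] ≡ [ k ]
  shift-root-child i x k with i ≟ k
  ... | yes _ = refl
  ... | no  _ = refl

  unshift-root-child : ∀ i x k → unshift (i ∷ x) [ k ] ≡ just [ k ]
  unshift-root-child i x k with i ≟ k
  ... | yes _ = refl
  ... | no  _ = refl

  insertMap : (List ℕ → List ℕ) → List ℕ → List ℕ → List ℕ
  insertMap φ x y = maybe′ (shift (φ x) ∘ φ) (φ x ++ [ 0 ]) (unshift x y)

  insertMap-old : ∀ φ x y {y₀} → unshift x y ≡ just y₀ → insertMap φ x y ≡ shift (φ x) (φ y₀)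
  insertMap-old φ x y = cong (maybe′ _ _)

  insertMap-new : ∀ φ x → insertMap φ x (x ++ [ 0 ]) ≡ φ x ++ [ 0 ]
  insertMap-new φ x = cong (maybe′ _ _) (unshift-new x)

  insertMap-self : ∀ φ x → insertMap φ x x ≡ φ x
  insertMap-self φ x = trans (insertMap-old φ x x (unshift-self x)) (shift-self (φ x))

  insert-At : ∀ {Γ Γ₁ : Sequent} {x fs ds e y hs es} →
              Rep Γ x (node fs ds) (node fs (e ∷ ds)) Γ₁ → At Γ y (node hs es) →
              Σ Children λ es′ → At Γ₁ (shift x y) (node hs es′) ×
                (∀ {k b E} → Child es k b E →
                   Σ ℕ λ k′ → Σ Sequent λ E′ → shift x (y ++ [ k ]) ≡ shift x y ++ [ k′ ] × Child es′ k′ b E′)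
  insert-At here here        = _ , here , λ c → _ , _ , refl , cs c
  insert-At here (there c p) = _ , there (cs c) p , λ c′ → _ , _ , refl , c′
  insert-At {x = i ∷ x} (there rl r) here =
    _ , here , λ {k} c → let (E′ , c′) = Child-sameLabels (RepL-labels rl) c in k , E′ , shift-root-child i x k , c′
  insert-At {x = i ∷ x} (there rl r) (there {k = j} c p) with i ≟ j
  ... | yes refl with refl , refl ← Child-functional c (RepL-old rl) =
    let (es′ , p′ , f) = insert-At r p
    in es′ , there (RepL-new rl) p′ , λ c′ → let (k′ , E′ , e , c″) = f c′ in k′ , E′ , cong (i ∷_) e , c″
  ... | no i≢j with RepL-child rl c
  ...   | inj₁ (j≡i , _) = contradiction (sym j≡i) i≢j
  ...   | inj₂ c′        = _ , there c′ p , λ c″ → _ , _ , refl , c″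

  insert-At⁻¹ : ∀ {Γ Γ₁ : Sequent} {x fs ds a A y hs es} →
                Rep Γ x (node fs ds) (node fs ((a , node (A ∷ []) []) ∷ ds)) Γ₁ → At Γ₁ y (node hs es) →
                (y ≡ x ++ [ 0 ] × node hs es ≡ node (A ∷ []) [])
                ⊎ Σ (List ℕ) λ y₀ → Σ Children λ es₀ → unshift x y ≡ just y₀ × At Γ y₀ (node hs es₀) ×
                    (∀ {k b E} → Child es k b E →
                       (y ≡ x × k ≡ 0 × b ≡ a)
                       ⊎ Σ ℕ λ k₀ → Σ Sequent λ E₀ →
                           unshift x (y ++ [ k ]) ≡ just (y₀ ++ [ k₀ ]) × Child es₀ k₀ b E₀)
  insert-At⁻¹ here here =
    inj₂ ([] , _ , refl , here , λ { cz → inj₁ (refl , refl , refl) ; (cs c) → inj₂ (_ , _ , refl , c) })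
  insert-At⁻¹ here (there cz here)         = inj₁ (refl , refl)
  insert-At⁻¹ here (there cz (there () _))
  insert-At⁻¹ here (there (cs c) p)        = inj₂ (_ , _ , refl , there c p , λ c′ → inj₂ (_ , _ , refl , c′))
  insert-At⁻¹ {x = i ∷ x} (there rl r) here =
    inj₂ ([] , _ , refl , here ,
          λ {k} c → let (E₀ , c₀) = Child-sameLabels (sym (RepL-labels rl)) c
                    in inj₂ (k , E₀ , unshift-root-child i x k , c₀))
  insert-At⁻¹ {x = i ∷ x} (there rl r) (there {k = j} c p) with i ≟ j
  ... | yes refl with refl , refl ← Child-functional c (RepL-new rl) with insert-At⁻¹ r p
  ...   | inj₁ (y≡ , leaf) = inj₁ (cong (i ∷_) y≡ , leaf)
  ...   | inj₂ (y₀ , es₀ , eu , p₀ , f) =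
    inj₂ (i ∷ y₀ , es₀ , cong (Maybe.map (i ∷_)) eu , there (RepL-old rl) p₀ , λ c′ → case f c′ of λ where
      (inj₁ (y≡x , k≡0 , b≡a))   → inj₁ (cong (i ∷_) y≡x , k≡0 , b≡a)
      (inj₂ (k₀ , E₀ , eu′ , c₀)) → inj₂ (k₀ , E₀ , cong (Maybe.map (i ∷_)) eu′ , c₀))
  insert-At⁻¹ {x = i ∷ x} (there rl r) (there {k = j} c p) | no i≢j with RepL-child (RepL-sym rl) c
  ... | inj₁ (j≡i , _) = contradiction (sym j≡i) i≢j
  ... | inj₂ c′        = inj₂ (_ , _ , refl , there c′ p , λ c″ → inj₂ (_ , _ , refl , c″))

  module _ {S : STS {Sig}} where

    Step-++⁺ˡ : ∀ z {p q} → Step S p q → Step S (z ++ p) (z ++ q)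
    Step-++⁺ˡ z (step {u} {v} x y r) = subst₂ (Step S) (++-assoc z x (u ++ y)) (++-assoc z x (v ++ y)) (step (z ++ x) y r)

    Step-++⁺ʳ : ∀ z {p q} → Step S p q → Step S (p ++ z) (q ++ z)
    Step-++⁺ʳ z (step {u} {v} x y r) = subst₂ (Step S) (reassoc u) (reassoc v) (step x (y ++ z) r)
      where
        reassoc : ∀ u → x ++ u ++ y ++ z ≡ (x ++ u ++ y) ++ z
        reassoc u = sym (trans (++-assoc x (u ++ y) z) (cong (x ++_) (++-assoc u y z)))

    ⇒-++ : ∀ {p p′ q q′} → p ⇒[ S ] p′ → q ⇒[ S ] q′ → (p ++ q) ⇒[ S ] (p′ ++ q′)
    ⇒-++ {p′ = p′} {q = q} p⇒p′ q⇒q′ =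
      gmap (_++ q) (Step-++⁺ʳ q) p⇒p′ ◅◅ gmap (p′ ++_) (Step-++⁺ˡ p′) q⇒q′

    L-rule : ∀ {a w} → S [ a ] w → L S a w
    L-rule {w = w} r = subst (Step S [ _ ]) (++-identityʳ w) (step [] [] r) ◅ ε

  spine : List Sig → List ℕ
  spine = map (λ _ → 0)

  At-wrap : ∀ w {Δ E : Sequent} {y} → At Δ y E → At (wrap w Δ) (spine w ++ y) E
  At-wrap []      p = p
  At-wrap (_ ∷ w) p = there cz (At-wrap w p)

  At-,,⁺ˡ : ∀ {Δ Γ : Sequent} {y hs es} → At Δ y (node hs es) →
            Σ Formulae λ hs′ → Σ Children λ es′ → At (Δ ,, Γ) y (node hs′ es′) ×
              hs ⊆ hs′ × (∀ {k b E} → Child es k b E → Child es′ k b E)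
  At-,,⁺ˡ {Γ = node _ _} here        = _ , _ , here , ∈-++⁺ˡ , Child-++⁺ˡ
  At-,,⁺ˡ {Γ = node _ _} (there c p) = _ , _ , there (Child-++⁺ˡ c) p , id , id

  -- Address maps for replacing the first child a{Δ} of the root by b{v{Δ}} (expandMap v), and
  -- for merging it into the root when Δ has n children (collapseMap n).
  expandMap : List Sig → List ℕ → List ℕ
  expandMap v []          = []
  expandMap v (zero ∷ y)  = 0 ∷ spine v ++ y
  expandMap v (suc k ∷ y) = suc k ∷ y

  expandMap-child : ∀ v i y k → expandMap v ((i ∷ y) ++ [ k ]) ≡ expandMap v (i ∷ y) ++ [ k ]
  expandMap-child v zero    y k = cong (0 ∷_) (sym (++-assoc (spine v) y [ k ]))
  expandMap-child v (suc i) y k = refl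

  collapseMap : ℕ → List ℕ → List ℕ
  collapseMap n []          = []
  collapseMap n (zero ∷ y)  = y
  collapseMap n (suc k ∷ y) = n + k ∷ y

  module _ (bar : Sig → Sig) where

    Walk-++ : ∀ {Γ : Sequent} {x y z w₁ w₂} → Walk bar Γ x w₁ y → Walk bar Γ y w₂ z → Walk bar Γ x (w₁ ++ w₂) z
    Walk-++ (nil _)      q = q
    Walk-++ (down p c r) q = down p c (Walk-++ r q)
    Walk-++ (up p c r)   q = up p c (Walk-++ r q)

    Walk-child : ∀ {Γ : Sequent} {x fs ds k a E} → At Γ x (node fs ds) → Child ds k a E → Walk bar Γ x [ a ] (x ++ [ k ])
    Walk-child p c = down p c (nil (At-child p c))

    Walk-parent : ∀ {Γ : Sequent} {x fs ds k a E} → At Γ x (node fs ds) → Child ds k a E → Walk bar Γ (x ++ [ k ]) [ bar a ] x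
    Walk-parent p c = up p c (nil p)

    Walk-wrap↓ : ∀ {Γ Δ : Sequent} c w {x fs ds} → At Γ x (node fs ((c , wrap w Δ) ∷ ds)) →
                 Walk bar Γ x (c ∷ w) (x ++ spine (c ∷ w))
    Walk-wrap↓ c []       p = Walk-child p cz
    Walk-wrap↓ {Γ} c (c′ ∷ w) {x} p =
      down p cz (subst (Walk bar Γ (x ++ [ 0 ]) (c′ ∷ w)) (++-assoc x [ 0 ] (spine (c′ ∷ w)))
                       (Walk-wrap↓ c′ w (At-child p cz)))

    Walk-wrap↑ : ∀ {Γ Δ : Sequent} c w {x fs ds} → At Γ x (node fs ((c , wrap w Δ) ∷ ds)) →
                 Walk bar Γ (x ++ spine (c ∷ w)) (barW bar (c ∷ w)) x
    Walk-wrap↑ c []       p = Walk-parent p cz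
    Walk-wrap↑ {Γ} c (c′ ∷ w) {x} p =
      subst₂ (λ y u → Walk bar Γ y u x)
             (++-assoc x [ 0 ] (spine (c′ ∷ w))) (sym (unfold-reverse (bar c) (map bar (c′ ∷ w))))
        (Walk-++ (Walk-wrap↑ c′ w (At-child p cz)) (Walk-parent p cz))

    module _ (S : STS {Sig}) where

      record Simulation (φ : List ℕ → List ℕ) (Γ Γ′ : Sequent) : Set where
        field
          sim-node    : ∀ {x fs ds} → At Γ x (node fs ds) → NodeAt Γ′ (φ x)
          sim-formula : ∀ {x fs ds A} → At Γ x (node fs ds) → A ∈ fs → FormulaAt Γ′ (φ x) A
          sim-down    : ∀ {x fs ds k a E} → At Γ x (node fs ds) → Child ds k a E →
                        ∃[ w ] L S a w × Walk bar Γ′ (φ x) w (φ (x ++ [ k ]))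
          sim-up      : ∀ {x fs ds k a E} → At Γ x (node fs ds) → Child ds k a E →
                        ∃[ w ] L S (bar a) w × Walk bar Γ′ (φ (x ++ [ k ])) w (φ x)
      open Simulation

      simulate-walk : ∀ {φ Γ Γ′ x w y} → Simulation φ Γ Γ′ → Walk bar Γ x w y →
                      ∃[ w′ ] w ⇒[ S ] w′ × Walk bar Γ′ (φ x) w′ (φ y)
      simulate-walk m (nil {n = node _ _} p) = [] , ε , nil (proj₂ (proj₂ (sim-node m p)))
      simulate-walk m (down p c q) =
        let (w₁ , a⇒w₁ , walk₁) = sim-down m p c
            (w₂ , w⇒w₂ , walk₂) = simulate-walk m q
        in w₁ ++ w₂ , ⇒-++ a⇒w₁ w⇒w₂ , Walk-++ walk₁ walk₂
      simulate-walk m (up p c q) =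
        let (w₁ , a⇒w₁ , walk₁) = sim-up m p c
            (w₂ , w⇒w₂ , walk₂) = simulate-walk m q
        in w₁ ++ w₂ , ⇒-++ a⇒w₁ w⇒w₂ , Walk-++ walk₁ walk₂

      _⨾_ : ∀ {φ ψ Γ Γ′ Γ″} → Simulation φ Γ Γ′ → Simulation ψ Γ′ Γ″ → Simulation (ψ ∘ φ) Γ Γ″
      sim-node (m ⨾ m′) p = let (_ , _ , p′) = sim-node m p in sim-node m′ p′
      sim-formula (m ⨾ m′) p A∈ = let (_ , _ , p′ , A∈′) = sim-formula m p A∈ in sim-formula m′ p′ A∈′
      sim-down (m ⨾ m′) p c =
        let (w , a⇒w , walk) = sim-down m p c ; (w′ , w⇒w′ , walk′) = simulate-walk m′ walk
        in w′ , a⇒w ◅◅ w⇒w′ , walk′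
      sim-up (m ⨾ m′) p c =
        let (w , a⇒w , walk) = sim-up m p c ; (w′ , w⇒w′ , walk′) = simulate-walk m′ walk
        in w′ , a⇒w ◅◅ w⇒w′ , walk′

      update-simulation : ∀ {Γ Γ₁ x As fs ds} → Rep Γ x (node fs ds) (node (As ++ fs) ds) Γ₁ → Simulation id Γ Γ₁
      sim-node (update-simulation r) p = let (_ , _ , p′ , _) = update-At r p in _ , _ , p′
      sim-formula (update-simulation {As = As} r) p A∈ with update-At r p
      ... | _ , _ , p′ , _ , inj₁ refl            = _ , _ , p′ , A∈
      ... | _ , _ , p′ , _ , inj₂ (_ , refl , refl) = _ , _ , p′ , ∈-++⁺ʳ As A∈
      sim-down (update-simulation r) p c =
        let (_ , _ , p′ , l , _) = update-At r p ; (_ , c′) = Child-sameLabels l c in _ , ε , Walk-child p′ c′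
      sim-up (update-simulation r) p c =
        let (_ , _ , p′ , l , _) = update-At r p ; (_ , c′) = Child-sameLabels l c in _ , ε , Walk-parent p′ c′

      insert-simulation : ∀ {Γ Γ₁ x fs ds e} → Rep Γ x (node fs ds) (node fs (e ∷ ds)) Γ₁ →
                          Simulation (shift x) Γ Γ₁
      sim-node (insert-simulation r) p = let (_ , p′ , _) = insert-At r p in _ , _ , p′
      sim-formula (insert-simulation r) p A∈ = let (_ , p′ , _) = insert-At r p in _ , _ , p′ , A∈
      sim-down (insert-simulation r) p c =
        let (_ , p′ , f) = insert-At r p ; (_ , _ , e , c′) = f c
        in _ , ε , subst (Walk bar _ _ _) (sym e) (Walk-child p′ c′)
      sim-up (insert-simulation r) p c =
        let (_ , p′ , f) = insert-At r p ; (_ , _ , e , c′) = f c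
        in _ , ε , subst (λ y → Walk bar _ y _ _) (sym e) (Walk-parent p′ c′)

      add-formulae : ∀ {φ Γ Γ₁ Γ′ Γ′₁ x As fs fs′ ds ds′} → Simulation φ Γ Γ′ →
                     Rep Γ x (node fs ds) (node (As ++ fs) ds) Γ₁ →
                     Rep Γ′ (φ x) (node fs′ ds′) (node (As ++ fs′) ds′) Γ′₁ → Simulation φ Γ₁ Γ′₁
      add-formulae {φ} {Γ′₁ = Γ′₁} {As = As} m r r′ = record
        { sim-node    = λ p → let (_ , _ , p₀ , _) = update-At (Rep-sym r) p in sim-node m′ p₀
        ; sim-formula = formula
        ; sim-down    = λ p c → let (_ , _ , p₀ , l , _) = update-At (Rep-sym r) p
                                in sim-down m′ p₀ (proj₂ (Child-sameLabels l c))
        ; sim-up      = λ p c → let (_ , _ , p₀ , l , _) = update-At (Rep-sym r) p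
                                in sim-up m′ p₀ (proj₂ (Child-sameLabels l c))
        }
        where
          m′ : Simulation φ _ Γ′₁
          m′ = m ⨾ update-simulation r′

          formula : ∀ {y hs es A} → At _ y (node hs es) → A ∈ hs → FormulaAt Γ′₁ (φ y) A
          formula p A∈ with update-At (Rep-sym r) p
          ... | _ , _ , p₀ , _ , inj₁ refl = sim-formula m′ p₀ A∈
          ... | _ , _ , p₀ , _ , inj₂ (refl , refl , refl) with ∈-++⁻ As A∈
          ...   | inj₁ A∈As = _ , _ , Rep-new r′ , ∈-++⁺ˡ A∈As
          ...   | inj₂ A∈fs = sim-formula m′ p₀ A∈fs

      add-box : ∀ {φ Γ Γ₁ Γ′ Γ′₁ x fs fs′ ds ds′ a A} → Simulation φ Γ Γ′ →
                Rep Γ x (node fs ds) (node fs ((a , node (A ∷ []) []) ∷ ds)) Γ₁ →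
                Rep Γ′ (φ x) (node fs′ ds′) (node fs′ ((a , node (A ∷ []) []) ∷ ds′)) Γ′₁ →
                Simulation (insertMap φ x) Γ₁ Γ′₁
      add-box {φ} {Γ₁ = Γ₁} {Γ′₁ = Γ′₁} {x = x} {a = a} {A = A} m r r′ =
        record { sim-node = node′ ; sim-formula = formula ; sim-down = down′ ; sim-up = up′ }
        where
          m′ : Simulation (shift (φ x) ∘ φ) _ Γ′₁
          m′ = m ⨾ insert-simulation r′

          leaf : At Γ′₁ (φ x ++ [ 0 ]) (node (A ∷ []) [])
          leaf = At-child (Rep-new r′) cz

          node′ : ∀ {y hs es} → At Γ₁ y (node hs es) → NodeAt Γ′₁ (insertMap φ x y)
          node′ {y} p with insert-At⁻¹ r p
          ... | inj₁ (refl , refl)         = subst (NodeAt Γ′₁) (sym (insertMap-new φ x)) (_ , _ , leaf)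
          ... | inj₂ (_ , _ , eu , p₀ , _) = subst (NodeAt Γ′₁) (sym (insertMap-old φ x y eu)) (sim-node m′ p₀)

          formula : ∀ {y hs es B} → At Γ₁ y (node hs es) → B ∈ hs → FormulaAt Γ′₁ (insertMap φ x y) B
          formula {y} p B∈ with insert-At⁻¹ r p
          ... | inj₁ (refl , refl) =
            subst (λ y → FormulaAt Γ′₁ y _) (sym (insertMap-new φ x)) (_ , _ , leaf , B∈)
          ... | inj₂ (_ , _ , eu , p₀ , _) =
            subst (λ y → FormulaAt Γ′₁ y _) (sym (insertMap-old φ x y eu)) (sim-formula m′ p₀ B∈)

          down′ : ∀ {y hs es k b E} → At Γ₁ y (node hs es) → Child es k b E →
                  ∃[ w ] L S b w × Walk bar Γ′₁ (insertMap φ x y) w (insertMap φ x (y ++ [ k ]))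
          down′ {y} {k = k} p c with insert-At⁻¹ r p
          ... | inj₁ (refl , refl) = case c of λ ()
          ... | inj₂ (_ , _ , eu , p₀ , f) with f c
          ...   | inj₁ (refl , refl , refl) =
            _ , ε , subst₂ (λ s t → Walk bar Γ′₁ s _ t) (sym (insertMap-self φ x)) (sym (insertMap-new φ x))
                      (Walk-child (Rep-new r′) cz)
          ...   | inj₂ (_ , _ , eu′ , c₀) =
            let (w , b⇒w , walk) = sim-down m′ p₀ c₀
            in w , b⇒w , subst₂ (λ s t → Walk bar Γ′₁ s w t)
                                (sym (insertMap-old φ x y eu)) (sym (insertMap-old φ x (y ++ [ k ]) eu′)) walk

          up′ : ∀ {y hs es k b E} → At Γ₁ y (node hs es) → Child es k b E →
                ∃[ w ] L S (bar b) w × Walk bar Γ′₁ (insertMap φ x (y ++ [ k ])) w (insertMap φ x y)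
          up′ {y} {k = k} p c with insert-At⁻¹ r p
          ... | inj₁ (refl , refl) = case c of λ ()
          ... | inj₂ (_ , _ , eu , p₀ , f) with f c
          ...   | inj₁ (refl , refl , refl) =
            _ , ε , subst₂ (λ s t → Walk bar Γ′₁ s _ t) (sym (insertMap-new φ x)) (sym (insertMap-self φ x))
                      (Walk-parent (Rep-new r′) cz)
          ...   | inj₂ (_ , _ , eu′ , c₀) =
            let (w , b⇒w , walk) = sim-up m′ p₀ c₀
            in w , b⇒w , subst₂ (λ s t → Walk bar Γ′₁ s w t)
                                (sym (insertMap-old φ x (y ++ [ k ]) eu′)) (sym (insertMap-old φ x y eu)) walk

      id-at : ∀ {Γ x p h} → FormulaAt Γ x (pos p) → FormulaAt Γ x (neg p) → Der bar S h Γ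
      id-at (_ , _ , p₁ , p∈) (_ , _ , p₂ , ¬p∈) with refl ← At-functional p₁ p₂ = id-d p₁ p∈ ¬p∈

      premise : ∀ {φ Γ Γ₁ Γ′ x As fs fs′ ds ds′} → Simulation φ Γ Γ′ →
                Rep Γ x (node fs ds) (node (As ++ fs) ds) Γ₁ → At Γ′ (φ x) (node fs′ ds′) →
                ∃[ Γ′₁ ] Rep Γ′ (φ x) (node fs′ ds′) (node (As ++ fs′) ds′) Γ′₁ × Simulation φ Γ₁ Γ′₁
      premise m r p′ = let (_ , r′) = At⇒Rep p′ _ in _ , r′ , add-formulae m r r′

      simulate : ∀ {φ Γ Γ′ h} → Simulation φ Γ Γ′ → Der bar S h Γ → Der bar S h Γ′
      simulate m (id-d p p∈ ¬p∈) = id-at (sim-formula m p p∈) (sim-formula m p ¬p∈)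
      simulate m (and-d {A = A} {B = B} A∧B∈ r₁ r₂ d₁ d₂) =
        let (_ , _ , p′ , A∧B∈′) = sim-formula m (Rep-old r₁) A∧B∈
            (_ , r₁′ , m₁) = premise {As = [ A ]} m r₁ p′
            (_ , r₂′ , m₂) = premise {As = [ B ]} m r₂ p′
        in and-d A∧B∈′ r₁′ r₂′ (simulate m₁ d₁) (simulate m₂ d₂)
      simulate m (or-d {A = A} {B = B} A∨B∈ r d) =
        let (_ , _ , p′ , A∨B∈′) = sim-formula m (Rep-old r) A∨B∈
            (_ , r′ , m₁) = premise {As = A ∷ B ∷ []} m r p′
        in or-d A∨B∈′ r′ (simulate m₁ d)
      simulate m (box-d {a = a} {A = A} □A∈ r d) =
        let (_ , _ , p′ , □A∈′) = sim-formula m (Rep-old r) □A∈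
            (_ , r′) = At⇒Rep p′ _
        in box-d □A∈′ r′ (simulate (add-box m r r′) d)
      simulate m (dia-up {A = A} ◇A∈ c rl r d) =
        let (_ , _ , p′ , ◇A∈′) = sim-formula m (Rep-old r) ◇A∈
            (_ , _ , q′) = sim-node m (At-child (Rep-old r) c)
            (_ , r′ , m₁) = premise {As = [ A ]} m (Rep-child r rl) q′
        in p-S p′ ◇A∈′ r′ (sim-down m (Rep-old r) c) (simulate m₁ d)
      simulate m (dia-dn {A = A} c ◇A∈ r d) =
        let (_ , _ , p′ , ◇A∈′) = sim-formula m (At-child (Rep-old r) c) ◇A∈
            (_ , _ , q′) = sim-node m (Rep-old r)
            (_ , r′ , m₁) = premise {As = [ A ]} m r q′
        in p-S p′ ◇A∈′ r′ (sim-up m (Rep-old r) c) (simulate m₁ d)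
      simulate m (p-S {A = A} p ◇A∈ r (w , a⇒w , walk) d) =
        let (_ , _ , p′ , ◇A∈′) = sim-formula m p ◇A∈
            (w′ , w⇒w′ , walk′) = simulate-walk m walk
            (_ , _ , q′) = sim-node m (Rep-old r)
            (_ , r′ , m₁) = premise {As = [ A ]} m r q′
        in p-S p′ ◇A∈′ r′ (w′ , a⇒w ◅◅ w⇒w′ , walk′) (simulate m₁ d)

      expand-simulation : ∀ {a b v fs ds} {Δ : Sequent} → L S a (b ∷ v) → L S (bar a) (barW bar (b ∷ v)) →
                          Simulation (expandMap v) (node fs ((a , Δ) ∷ ds)) (node fs ((b , wrap v Δ) ∷ ds))
      expand-simulation {a} {b} {v} {fs} {ds} {Δ} a⇒bv ā⇒bv = record
        { sim-node    = node′
        ; sim-formula = formula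
        ; sim-down    = down′
        ; sim-up      = up′
        }
        where
          Γ Γ′ : Sequent
          Γ  = node fs ((a , Δ) ∷ ds)
          Γ′ = node fs ((b , wrap v Δ) ∷ ds)

          root-spine : expandMap v [ 0 ] ≡ spine (b ∷ v)
          root-spine = cong (0 ∷_) (++-identityʳ (spine v))

          image : ∀ {i y E} → At Γ (i ∷ y) E → At Γ′ (expandMap v (i ∷ y)) E
          image (there cz p)     = there cz (At-wrap v p)
          image (there (cs c) p) = there (cs c) p

          node′ : ∀ {y hs es} → At Γ y (node hs es) → NodeAt Γ′ (expandMap v y)
          node′ here          = _ , _ , here
          node′ p@(there _ _) = _ , _ , image p

          formula : ∀ {y hs es A} → At Γ y (node hs es) → A ∈ hs → FormulaAt Γ′ (expandMap v y) A
          formula here A∈          = _ , _ , here , A∈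
          formula p@(there _ _) A∈ = _ , _ , image p , A∈

          down′ : ∀ {y hs es k c E} → At Γ y (node hs es) → Child es k c E →
                  ∃[ w ] L S c w × Walk bar Γ′ (expandMap v y) w (expandMap v (y ++ [ k ]))
          down′ here cz     = _ , a⇒bv , subst (Walk bar Γ′ [] (b ∷ v)) (sym root-spine) (Walk-wrap↓ b v here)
          down′ here (cs c) = _ , ε , Walk-child here (cs c)
          down′ {k = k} p@(there {k = i} {x = y} _ _) c =
            _ , ε , subst (Walk bar Γ′ _ _) (sym (expandMap-child v i y k)) (Walk-child (image p) c)

          up′ : ∀ {y hs es k c E} → At Γ y (node hs es) → Child es k c E →
                ∃[ w ] L S (bar c) w × Walk bar Γ′ (expandMap v (y ++ [ k ])) w (expandMap v y)
          up′ here cz     =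
            _ , ā⇒bv , subst (λ y → Walk bar Γ′ y (barW bar (b ∷ v)) []) (sym root-spine) (Walk-wrap↑ b v here)
          up′ here (cs c) = _ , ε , Walk-parent here (cs c)
          up′ {k = k} p@(there {k = i} {x = y} _ _) c =
            _ , ε , subst (λ z → Walk bar Γ′ z _ _) (sym (expandMap-child v i y k)) (Walk-parent (image p) c)

      collapse-simulation : ∀ {a fs gs ds es} → L S a [] → L S (bar a) [] →
                            Simulation (collapseMap (length es)) (node fs ((a , node gs es) ∷ ds)) (node gs es ,, node fs ds)
      collapse-simulation {a} {fs} {gs} {ds} {es} a⇒ε ā⇒ε = record
        { sim-node    = node′
        ; sim-formula = formula
        ; sim-down    = down′
        ; sim-up      = up′
        }
        where
          Γ Γ′ : Sequent
          Γ  = node fs ((a , node gs es) ∷ ds)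
          Γ′ = node gs es ,, node fs ds

          φ : List ℕ → List ℕ
          φ = collapseMap (length es)

          inner : ∀ {i y hs es₁} → At Γ (i ∷ y) (node hs es₁) →
                  Σ Formulae λ hs′ → Σ Children λ es′ → At Γ′ (φ (i ∷ y)) (node hs′ es′) ×
                    hs ⊆ hs′ × (∀ {k b E} → Child es₁ k b E → Child es′ k b E)
          inner (there cz p)     = At-,,⁺ˡ p
          inner (there (cs c) p) = _ , _ , there (Child-++⁺ʳ es c) p , id , id

          node′ : ∀ {y hs es₁} → At Γ y (node hs es₁) → NodeAt Γ′ (φ y)
          node′ here          = _ , _ , here
          node′ p@(there _ _) = let (_ , _ , p′ , _) = inner p in _ , _ , p′

          formula : ∀ {y hs es₁ A} → At Γ y (node hs es₁) → A ∈ hs → FormulaAt Γ′ (φ y) A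
          formula here A∈          = _ , _ , here , ∈-++⁺ʳ gs A∈
          formula p@(there _ _) A∈ = let (_ , _ , p′ , hs⊆ , _) = inner p in _ , _ , p′ , hs⊆ A∈

          down′ : ∀ {y hs es₁ k b E} → At Γ y (node hs es₁) → Child es₁ k b E →
                  ∃[ w ] L S b w × Walk bar Γ′ (φ y) w (φ (y ++ [ k ]))
          down′ here cz              = [] , a⇒ε , nil here
          down′ here (cs c)          = _ , ε , Walk-child here (Child-++⁺ʳ es c)
          down′ p@(there cz _) c     = let (_ , _ , p′ , _ , f) = inner p in _ , ε , Walk-child p′ (f c)
          down′ p@(there (cs _) _) c = let (_ , _ , p′ , _ , f) = inner p in _ , ε , Walk-child p′ (f c)

          up′ : ∀ {y hs es₁ k b E} → At Γ y (node hs es₁) → Child es₁ k b E →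
                ∃[ w ] L S (bar b) w × Walk bar Γ′ (φ (y ++ [ k ])) w (φ y)
          up′ here cz              = [] , ā⇒ε , nil here
          up′ here (cs c)          = _ , ε , Walk-parent here (Child-++⁺ʳ es c)
          up′ p@(there cz _) c     = let (_ , _ , p′ , _ , f) = inner p in _ , ε , Walk-parent p′ (f c)
          up′ p@(there (cs _) _) c = let (_ , _ , p′ , _ , f) = inner p in _ , ε , Walk-parent p′ (f c)

      context-free-rule-admissible : Closed bar S → ∀ {a v h} {Δ Γ : Sequent} → S [ a ] v →
                                     Der bar S h (wrap [ a ] Δ ,, Γ) → Der bar S h (wrap v Δ ,, Γ)
      context-free-rule-admissible closed {v = _ ∷ _} {Γ = node _ _} r =
        simulate (expand-simulation (L-rule r) (L-rule (closed _ _ r)))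
      context-free-rule-admissible closed {v = []} {Δ = node _ _} {Γ = node _ _} r =
        simulate (collapse-simulation (L-rule r) (L-rule (closed _ _ r)))

lemma4p9 : (n : ℕ) (bar : Fin n → Fin n) → (∀ a → bar (bar a) ≡ a) →
           (S : STS {Fin n}) → Closed bar S → ContextFree S →
           ∀ (u v : List (Fin n)) → S u v →
           ∀ (h : ℕ) (Δ Γ : Seq {Fin n}) →
           Der bar S h (wrap u Δ ,, Γ) → Der bar S h (wrap v Δ ,, Γ)
lemma4p9 _ bar _ S closed context-free u v r _ _ _ with context-free u v r
... | _ , refl = context-free-rule-admissible bar S closed r
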